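{- Let $G\in\mathcal{C}$ be connected and let $o$ be an extremal orientation of $G$. Then $d^o_+(v)\le 2$ for every vertex $v$.
   Context: All graphs are finite and simple. $\mathcal{C}$ is the class of graphs in which every connected component contains a cycle. An orientation $o$ of $G$ is valid if every vertex has in-degree at least $1$. For a directed graph, a total dominating set is a set $S$ such that every vertex has an in-neighbor in $S$, and $\gamma_t$ is the minimum size of such a set. A valid orientation $o$ of a connected graph $G\in\mathcal{C}$ is extremal if its total domination number equals $|V(G)|-1$. $d^o_+(v)$ is the out-degree of $v$ in $o$. -}

module Defs where

open import Data.Nat using (ℕ; suc; _≤_; _∸_)
open import Data.Fin using (Fin)
open import Data.Fin.Subset using (Subset; _∈_; ∣_∣)
open import Data.Vec using (tabulate)
open import Data.List using (List; []; _∷_; length)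
open import Data.List.Relation.Unary.Unique.Propositional using (Unique)
open import Data.Product using (Σ; ∃; _×_; _,_)
open import Data.Sum using (_⊎_)
open import Data.Empty using (⊥)
open import Relation.Nullary using (Dec; ¬_; does)
open import Relation.Binary.PropositionalEquality using (_≡_)

record Graph (n : ℕ) : Set₁ where
  field
    Adj   : Fin n → Fin n → Set
    adj?  : ∀ u v → Dec (Adj u v)
    sym   : ∀ {u v} → Adj u v → Adj v u
    irrefl : ∀ {u} → ¬ Adj u u
open Graph public

data Walk {n : ℕ} (G : Graph n) : Fin n → Fin n → Set where
  here : ∀ {u} → Walk G u u
  step : ∀ {u w v} → Adj G u w → Walk G w v → Walk G u v

Connected : ∀ {n} → Graph n → Set
Connected {n} G = ∀ (u v : Fin n) → Walk G u v

data PathList {n : ℕ} (G : Graph n) : Fin n → List (Fin n) → Fin n → Set where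
  end  : ∀ {u} → PathList G u [] u
  cons : ∀ {u w ws v} → Adj G u w → PathList G w ws v → PathList G u (w ∷ ws) v

-- A cycle: distinct vertices v₀, v₁, …, v_k with k ≥ 2 (at least three
-- vertices), consecutive ones adjacent and v_k adjacent to v₀.
HasCycle : ∀ {n} → Graph n → Set
HasCycle {n} G =
  Σ (Fin n) λ v₀ → Σ (List (Fin n)) λ vs → Σ (Fin n) λ vk →
    PathList G v₀ vs vk × Unique (v₀ ∷ vs) × 2 ≤ length vs × Adj G vk v₀

-- Connected graph in the class 𝒞: every component (here: the single one)
-- contains a cycle.
ConnectedInC : ∀ {n} → Graph n → Set
ConnectedInC G = Connected G × HasCycle G

record Orientation {n : ℕ} (G : Graph n) : Set₁ where
  field
    Arc     : Fin n → Fin n → Set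
    arc?    : ∀ u v → Dec (Arc u v)
    arc⇒adj : ∀ {u v} → Arc u v → Adj G u v
    adj⇒arc : ∀ {u v} → Adj G u v → Arc u v ⊎ Arc v u
    antisym : ∀ {u v} → Arc u v → Arc v u → ⊥
open Orientation public

Valid : ∀ {n} {G : Graph n} → Orientation G → Set
Valid {n} o = ∀ (v : Fin n) → ∃ λ u → Arc o u v

IsTDS : ∀ {n} {G : Graph n} → Orientation G → Subset n → Set
IsTDS {n} o S = ∀ (v : Fin n) → ∃ λ u → u ∈ S × Arc o u v

TotalDominationNumber : ∀ {n} {G : Graph n} → Orientation G → ℕ → Set
TotalDominationNumber {n} o k =
  (Σ (Subset n) λ S → IsTDS o S × ∣ S ∣ ≡ k) ×
  (∀ (S : Subset n) → IsTDS o S → k ≤ ∣ S ∣)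

Extremal : ∀ {n} {G : Graph n} → Orientation G → Set
Extremal {n} o = Valid o × TotalDominationNumber o (n ∸ 1)

outNbhd : ∀ {n} {G : Graph n} → Orientation G → Fin n → Subset n
outNbhd o v = tabulate λ w → does (arc? o v w)

outDeg : ∀ {n} {G : Graph n} → Orientation G → Fin n → ℕ
outDeg o v = ∣ outNbhd o v ∣

{-# OPTIONS --safe #-}
-- For x ≠ y the set V ∖ {x, y} is too small to be totally dominating, so some
-- vertex has all its in-neighbours in {x, y}.  Suppose v has three
-- out-neighbours.  If some y ≠ v has no private out-neighbour (a vertex whose
-- only in-neighbour is y), choose for each x ≠ y such a vertex g x for the pair
-- {x, y}; then x → g x, so g is injective on V ∖ {y}, and its image misses
-- every out-neighbour of v other than g v: two missed values contradict the
-- pigeonhole principle.  Otherwise every x ≠ v has a private out-neighbour; by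
-- validity these are distinct, and none of them is an out-neighbour of v.
module Submission where

open import Defs
open import Data.Nat using (ℕ; _≤_)
open import Data.Fin using (Fin)

open import Data.Nat using (suc; zero; z≤n; s≤s; _<_; _∸_)
open import Data.Nat.Properties using (1+n≰n; <⇒≱; ≤-trans; ≤-reflexive; ∸-monoˡ-≤)
open import Data.Fin as Fin using (punchOut; _≟_)
open import Data.Fin.Properties
  using (0≢1+n; suc-injective; punchInᵢ≢i; punchIn-injective; punchOut-injective; injective⇒≤; any?; all?; ¬∀⟶∃¬)
open import Data.Fin.Subset using (Subset; ⊤; _-_; inside; outside; ∣_∣; _∈_; _∉_; Empty)
open import Data.Fin.Subset.Properties
  using (_∈?_; ∈⊤; x∈p∧x≢y⇒x∈p-y; x∈p⇒∣p-x∣<∣p∣; ∣⊤∣≡n; Empty-unique; ∣⊥∣≡0)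
open import Data.Vec using (_∷_; [])
open import Data.Vec.Properties using ([]=⇒lookup; lookup∘tabulate)
open import Data.Vec.Base using (here; there)
open import Data.Product using (Σ; ∃; _×_; _,_; proj₁; proj₂)
open import Data.Sum using (_⊎_; inj₁; inj₂; [_,_]′)
import Data.Sum as Sum
open import Function using (_∘_; id)
open import Relation.Nullary using (Dec; yes; no; ¬_; does; contradiction)
open import Relation.Nullary.Decidable using (_×-dec_; _→-dec_; ¬?; decidable-stable)
open import Relation.Binary.Definitions using (DecidableEquality)
open import Relation.Binary.PropositionalEquality using (_≡_; _≢_; refl; trans; cong; subst)
import Relation.Binary.PropositionalEquality as ≡

Subsingleton : ∀ {A : Set} → (A → Set) → Set
Subsingleton P = ∀ {x y} → P x → P y → x ≡ y

AtMostTwo : ∀ {A : Set} → (A → Set) → Set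
AtMostTwo P = ∀ {x y z} → P x → P y → P z → x ≡ y ⊎ x ≡ z ⊎ y ≡ z

Subsingleton⇒AtMostTwo : ∀ {A : Set} {P : A → Set} → Subsingleton P → AtMostTwo P
Subsingleton⇒AtMostTwo unique px py _ = inj₁ (unique px py)

Subsingleton-except⇒AtMostTwo : ∀ {A : Set} {P : A → Set} → DecidableEquality A →
  (z : A) → Subsingleton (λ x → P x × x ≢ z) → AtMostTwo P
Subsingleton-except⇒AtMostTwo _≟ₐ_ z unique {x} {y} {w} px py pw
  with x ≟ₐ z | y ≟ₐ z | w ≟ₐ z
... | yes x≡z | yes y≡z | _       = inj₁ (trans x≡z (≡.sym y≡z))
... | yes x≡z | no _    | yes w≡z = inj₂ (inj₁ (trans x≡z (≡.sym w≡z)))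
... | yes _   | no y≢z  | no w≢z  = inj₂ (inj₂ (unique (py , y≢z) (pw , w≢z)))
... | no x≢z  | no y≢z  | _       = inj₁ (unique (px , x≢z) (py , y≢z))
... | no _    | yes y≡z | yes w≡z = inj₂ (inj₂ (trans y≡z (≡.sym w≡z)))
... | no x≢z  | yes _   | no w≢z  = inj₂ (inj₁ (unique (px , x≢z) (pw , w≢z)))

Subsingleton⇒∣p∣≤1 : ∀ {n} {p : Subset n} → Subsingleton (_∈ p) → ∣ p ∣ ≤ 1
Subsingleton⇒∣p∣≤1 {p = []}          _      = z≤n
Subsingleton⇒∣p∣≤1 {p = outside ∷ p} unique =
  Subsingleton⇒∣p∣≤1 λ x∈p y∈p → suc-injective (unique (there x∈p) (there y∈p))
Subsingleton⇒∣p∣≤1 {suc n} {p = inside ∷ p} unique =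
  s≤s (≤-reflexive (trans (cong ∣_∣ (Empty-unique p-empty)) (∣⊥∣≡0 n)))
  where
  p-empty : Empty p
  p-empty (x , x∈p) = 0≢1+n (unique here (there x∈p))

AtMostTwo⇒∣p∣≤2 : ∀ {n} {p : Subset n} → AtMostTwo (_∈ p) → ∣ p ∣ ≤ 2
AtMostTwo⇒∣p∣≤2 {p = []}          _        = z≤n
AtMostTwo⇒∣p∣≤2 {p = outside ∷ p} atMostTwo = AtMostTwo⇒∣p∣≤2 λ x∈p y∈p z∈p →
  Sum.map suc-injective (Sum.map suc-injective suc-injective)
    (atMostTwo (there x∈p) (there y∈p) (there z∈p))
AtMostTwo⇒∣p∣≤2 {p = inside ∷ p}  atMostTwo = s≤s (Subsingleton⇒∣p∣≤1 unique)
  where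
  unique : Subsingleton (_∈ p)
  unique x∈p y∈p with atMostTwo here (there x∈p) (there y∈p)
  ... | inj₁ 0≡1+x        = contradiction 0≡1+x 0≢1+n
  ... | inj₂ (inj₁ 0≡1+y) = contradiction 0≡1+y 0≢1+n
  ... | inj₂ (inj₂ x≡y)   = suc-injective x≡y

choose-away-from : ∀ {n} {P : Fin n → Fin n → Set} (c : Fin n) →
  (∀ {x} → x ≢ c → ∃ (P x)) → Σ (Fin n → Fin n) λ g → ∀ {x} → x ≢ c → P x (g x)
choose-away-from {n} {P} c choice = g , g-spec
  where
  g : Fin n → Fin n
  g x with x ≟ c
  ... | yes _   = x
  ... | no x≢c = proj₁ (choice x≢c)
  g-spec : ∀ {x} → x ≢ c → P x (g x)
  g-spec {x} x≢c with x ≟ c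
  ... | yes x≡c  = contradiction x≡c x≢c
  ... | no x≢c′ = proj₂ (choice x≢c′)

punctured-injection-misses≤1 : ∀ {n} (c : Fin n) (g : Fin n → Fin n) →
  (∀ {x x′} → x ≢ c → x′ ≢ c → g x ≡ g x′ → x ≡ x′) →
  ∀ {z₁ z₂} → (∀ {x} → x ≢ c → g x ≢ z₁) → (∀ {x} → x ≢ c → g x ≢ z₂) → z₁ ≡ z₂
punctured-injection-misses≤1 {suc zero} Fin.zero g _ {Fin.zero} {Fin.zero} _ _ = refl
punctured-injection-misses≤1 {suc (suc m)} c g g-injective {z₁} {z₂} misses₁ misses₂
  with z₁ ≟ z₂
... | yes z₁≡z₂ = z₁≡z₂
-- Deleting c from the domain of g and z₁, z₂ from its codomain leaves an
-- injection Fin (suc m) → Fin m.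
... | no z₁≢z₂  = contradiction (injective⇒≤ h-injective) 1+n≰n
  where
  g₁ : Fin (suc m) → Fin (suc m)
  g₁ i = punchOut {i = z₁} (misses₁ (punchInᵢ≢i c i) ∘ ≡.sym)
  h : Fin (suc m) → Fin m
  h i = punchOut {i = punchOut z₁≢z₂} {j = g₁ i}
    (misses₂ (punchInᵢ≢i c i) ∘ ≡.sym ∘ punchOut-injective z₁≢z₂ _)
  h-injective : ∀ {i j} → h i ≡ h j → i ≡ j
  h-injective {i} {j} =
    punchIn-injective c i j ∘ g-injective (punchInᵢ≢i c i) (punchInᵢ≢i c j)
      ∘ punchOut-injective {i = z₁} _ _ ∘ punchOut-injective {i = punchOut z₁≢z₂} _ _

∉⊤-x-y⇒≡x⊎≡y : ∀ {n} {u x y : Fin n} → u ∉ ⊤ - x - y → u ≡ x ⊎ u ≡ y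
∉⊤-x-y⇒≡x⊎≡y {u = u} {x} {y} u∉ with u ≟ x | u ≟ y
... | yes u≡x | _       = inj₁ u≡x
... | no _    | yes u≡y = inj₂ u≡y
... | no u≢x  | no u≢y  = contradiction (x∈p∧x≢y⇒x∈p-y (x∈p∧x≢y⇒x∈p-y ∈⊤ u≢x) u≢y) u∉

∣⊤-x-y∣<n∸1 : ∀ {n} {x y : Fin n} → x ≢ y → ∣ ⊤ - x - y ∣ < n ∸ 1
∣⊤-x-y∣<n∸1 {n} {x} {y} x≢y = ∸-monoˡ-≤ 1 (≤-trans (s≤s ∣⊤-x-y∣<∣⊤-x∣) ∣⊤-x∣<n)
  where
  ∣⊤-x-y∣<∣⊤-x∣ : ∣ ⊤ - x - y ∣ < ∣ ⊤ - x ∣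
  ∣⊤-x-y∣<∣⊤-x∣ = x∈p⇒∣p-x∣<∣p∣ (x∈p∧x≢y⇒x∈p-y ∈⊤ (x≢y ∘ ≡.sym))
  ∣⊤-x∣<n : ∣ ⊤ - x ∣ < n
  ∣⊤-x∣<n = subst (∣ ⊤ - x ∣ <_) (∣⊤∣≡n n) (x∈p⇒∣p-x∣<∣p∣ {n} {x} {⊤} ∈⊤)

module _ {n : ℕ} {G : Graph n} (o : Orientation G) where

  ∈-outNbhd⇒Arc : ∀ {v w} → w ∈ outNbhd o v → Arc o v w
  ∈-outNbhd⇒Arc {v} {w} w∈
    with arc? o v w | trans (≡.sym ([]=⇒lookup w∈)) (lookup∘tabulate (does ∘ arc? o v) w)
  ... | yes v→w | _ = v→w
  ... | no _    | ()

  PrivateOutNbr : Fin n → Fin n → Set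
  PrivateOutNbr x w = ∀ u → Arc o u w → u ≡ x

  HasPrivateOutNbr : Fin n → Set
  HasPrivateOutNbr x = ∃ (PrivateOutNbr x)

  hasPrivateOutNbr? : ∀ x → Dec (HasPrivateOutNbr x)
  hasPrivateOutNbr? x = any? λ w → all? λ u → arc? o u w →-dec u ≟ x

  DominatedBy : Subset n → Fin n → Set
  DominatedBy S w = ∃ λ u → u ∈ S × Arc o u w

  dominatedBy? : ∀ S w → Dec (DominatedBy S w)
  dominatedBy? S w = any? λ u → (u ∈? S) ×-dec arc? o u w

  InNbrsAmong : Fin n → Fin n → Fin n → Set
  InNbrsAmong x y w = ∀ u → Arc o u w → u ≡ x ⊎ u ≡ y

  γₜ≥n∸1⇒∃InNbrsAmong : (∀ S → IsTDS o S → n ∸ 1 ≤ ∣ S ∣) →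
    ∀ {x y} → x ≢ y → ∃ (InNbrsAmong x y)
  γₜ≥n∸1⇒∃InNbrsAmong γₜ≥n∸1 {x} {y} x≢y
    with ¬∀⟶∃¬ n _ (dominatedBy? (⊤ - x - y))
           (λ isTDS → <⇒≱ (∣⊤-x-y∣<n∸1 x≢y) (γₜ≥n∸1 _ isTDS))
  ... | w , undominated =
    w , λ u u→w → ∉⊤-x-y⇒≡x⊎≡y λ u∈S → undominated (u , u∈S , u→w)

  Subsingleton-outNbrs : Valid o → ∀ {v} → (∀ {x} → x ≢ v → HasPrivateOutNbr x) →
    Subsingleton (Arc o v)
  Subsingleton-outNbrs valid {v} hasPrivate v→a v→b =
    punctured-injection-misses≤1 v g g-injective (g-misses v→a) (g-misses v→b)
    where
    g : Fin n → Fin n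
    g = proj₁ (choose-away-from v hasPrivate)
    g-private : ∀ {x} → x ≢ v → PrivateOutNbr x (g x)
    g-private = proj₂ (choose-away-from v hasPrivate)
    g-injective : ∀ {x x′} → x ≢ v → x′ ≢ v → g x ≡ g x′ → x ≡ x′
    g-injective {x} x≢v x′≢v gx≡gx′ with valid (g x)
    ... | u , u→gx =
      trans (≡.sym (g-private x≢v u u→gx)) (g-private x′≢v u (subst (Arc o u) gx≡gx′ u→gx))
    g-misses : ∀ {t} → Arc o v t → ∀ {x} → x ≢ v → g x ≢ t
    g-misses v→t x≢v refl = x≢v (≡.sym (g-private x≢v _ v→t))

  AtMostTwo-outNbrs : (∀ {x y} → x ≢ y → ∃ (InNbrsAmong x y)) →
    ∀ {v y} → y ≢ v → ¬ HasPrivateOutNbr y → AtMostTwo (Arc o v)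
  AtMostTwo-outNbrs inNbrsAmong {v} {y} y≢v noPrivate =
    Subsingleton-except⇒AtMostTwo _≟_ (g v) λ (v→s , s≢gv) (v→t , t≢gv) →
      punctured-injection-misses≤1 y g g-injective (g-misses v→s s≢gv) (g-misses v→t t≢gv)
    where
    g : Fin n → Fin n
    g = proj₁ (choose-away-from y inNbrsAmong)
    g-among : ∀ {x} → x ≢ y → InNbrsAmong x y (g x)
    g-among = proj₂ (choose-away-from y inNbrsAmong)
    →g : ∀ {x} → x ≢ y → Arc o x (g x)
    →g {x} x≢y = decidable-stable (arc? o x (g x)) λ x↛gx →
      noPrivate (g x , λ u u→gx → [ (λ { refl → contradiction u→gx x↛gx }) , id ]′
                                      (g-among x≢y u u→gx))
    g-injective : ∀ {x x′} → x ≢ y → x′ ≢ y → g x ≡ g x′ → x ≡ x′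
    g-injective {x′ = x′} x≢y x′≢y gx≡gx′ =
      [ ≡.sym , (λ x′≡y → contradiction x′≡y x′≢y) ]′
        (g-among x≢y x′ (subst (Arc o x′) (≡.sym gx≡gx′) (→g x′≢y)))
    g-misses : ∀ {t} → Arc o v t → t ≢ g v → ∀ {x} → x ≢ y → g x ≢ t
    g-misses v→t t≢gv x≢y refl with g-among x≢y v v→t
    ... | inj₁ refl = t≢gv refl
    ... | inj₂ v≡y  = y≢v (≡.sym v≡y)

  extremal⇒AtMostTwo-outNbrs : Extremal o → ∀ v → AtMostTwo (Arc o v)
  extremal⇒AtMostTwo-outNbrs (valid , _ , γₜ≥n∸1) v
    with any? (λ y → ¬? (y ≟ v) ×-dec ¬? (hasPrivateOutNbr? y))
  ... | yes (y , y≢v , noPrivate) =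
    AtMostTwo-outNbrs (γₜ≥n∸1⇒∃InNbrsAmong γₜ≥n∸1) y≢v noPrivate
  ... | no ∄noPrivate = Subsingleton⇒AtMostTwo (Subsingleton-outNbrs valid λ {x} x≢v →
    decidable-stable (hasPrivateOutNbr? x) λ noPrivate → ∄noPrivate (x , x≢v , noPrivate))

corollary3 : ∀ (n : ℕ) (G : Graph n) → ConnectedInC G →
    (o : Orientation G) → Extremal o →
    ∀ (v : Fin n) → outDeg o v ≤ 2
corollary3 n G _ o extremal v = AtMostTwo⇒∣p∣≤2 λ x∈ y∈ z∈ →
  extremal⇒AtMostTwo-outNbrs o extremal v
    (∈-outNbhd⇒Arc o x∈) (∈-outNbhd⇒Arc o y∈) (∈-outNbhd⇒Arc o z∈)
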